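{- Let $\mathcal{P}\subset\mathbb{R}^d$ and $\mathcal{Q}\subset\mathbb{R}^e$ be integral convex polytopes of dimension $d$ and $e$ containing $\mathbf{0}_d$ and $\mathbf{0}_e$, respectively, let $K$ be a field, and let $\mathcal{A}\subset\mathbb{Z}^{d+1}$, $\mathcal{B}\subset\mathbb{Z}^{e+1}$ and $\mathcal{A}\oplus\mathcal{B}\subset\mathbb{Z}^{d+e+1}$ be the configurations arising from $\mathcal{P}$, $\mathcal{Q}$ and $\mathcal{P}\oplus\mathcal{Q}$, respectively. Suppose that $$(\mathcal{P}\oplus\mathcal{Q})\cap\mathbb{Z}^{d+e}=\mu(\mathcal{P}\cap\mathbb{Z}^d)\cup\nu(\mathcal{Q}\cap\mathbb{Z}^e).$$ Then $h(K[\mathcal{A}\oplus\mathcal{B}])=h(K[\mathcal{A}])\,h(K[\mathcal{B}])$. Furthermore, if $\mathcal{P}\oplus\mathcal{Q}$ possesses the integer decomposition property, then $\delta(\mathcal{P}\oplus\mathcal{Q})=\delta(\mathcal{P})\,\delta(\mathcal{Q})$.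
   Context: An integral convex polytope has all vertices with integer coordinates. Define $\mu:\mathbb{R}^d\to\mathbb{R}^{d+e}$, $\mu(\alpha)=(\alpha,\mathbf{0}_e)$, and $\nu:\mathbb{R}^e\to\mathbb{R}^{d+e}$, $\nu(\beta)=(\mathbf{0}_d,\beta)$; the free sum $\mathcal{P}\oplus\mathcal{Q}$ is the convex hull of $\mu(\mathcal{P})\cup\nu(\mathcal{Q})$ (a polytope of dimension $d+e$). For an integral convex polytope $\mathcal{R}\subset\mathbb{R}^k$ of dimension $k$, the configuration arising from $\mathcal{R}$ is $\{(\alpha,1)\in\mathbb{Z}^{k+1}:\alpha\in\mathcal{R}\cap\mathbb{Z}^k\}$. $\mathcal{R}$ possesses the integer decomposition property if for every $n\ge1$ and every $\gamma\in n\mathcal{R}\cap\mathbb{Z}^k$ there exist $\gamma^{(1)},\dots,\gamma^{(n)}\in\mathcal{R}\cap\mathbb{Z}^k$ with $\gamma=\sum_i\gamma^{(i)}$. With $i(\mathcal{R},n)=|n\mathcal{R}\cap\mathbb{Z}^k|$, the $\delta$-polynomial $\delta(\mathcal{R})=\sum_n\delta_n\lambda^n$ is defined by $(1-\lambda)^{k+1}[1+\sum_{n\ge1}i(\mathcal{R},n)\lambda^n]=\sum_n\delta_n\lambda^n$. For the configuration $\mathcal{C}$ arising from $\mathcal{R}$, the toric ring $K[\mathcal{C}]$ is the subring of $K[t_1^{\pm1},\dots,t_k^{\pm1},s]$ generated by the monomials $t^{\alpha}s$, $\alpha\in\mathcal{R}\cap\mathbb{Z}^k$, graded so that $(K[\mathcal{C}])_n$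 is the $K$-span of products of $n$ generators; with $H(K[\mathcal{C}],n)=\dim_K(K[\mathcal{C}])_n$, the $h$-polynomial $h(K[\mathcal{C}])=\sum_nh_n\lambda^n$ is defined by $(1-\lambda)^{k+1}\sum_{n\ge0}H(K[\mathcal{C}],n)\lambda^n=\sum_nh_n\lambda^n$. -}

module Defs where

open import Data.Nat as ℕ using (ℕ; zero; suc; _∸_)
open import Data.Integer as ℤ using (ℤ; +_)
open import Data.Rational as ℚ using (ℚ; 0ℚ; 1ℚ)
open import Data.Vec as V using (Vec; []; _∷_; _∷ʳ_; replicate)
open import Data.Vec.Relation.Unary.All as VA using ()
open import Data.List as L using (List; []; _∷_; length)
open import Data.List.Relation.Unary.All as LA using ()
open import Data.List.Relation.Unary.Unique.Propositional using (Unique)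
open import Data.List.Membership.Propositional using (_∈_)
open import Data.Product using (Σ; _×_)
open import Function using (_∘_)
open import Relation.Binary.PropositionalEquality using (_≡_)

toQ : ℤ → ℚ
toQ z = z ℚ./ 1

toQv : ∀ {k} → Vec ℤ k → Vec ℚ k
toQv = V.map toQ

natQ : ℕ → ℚ
natQ n = (+ n) ℚ./ 1

qzero : ∀ {k} → Vec ℚ k
qzero = replicate _ 0ℚ

qsum : List ℚ → ℚ
qsum []       = 0ℚ
qsum (c ∷ cs) = c ℚ.+ qsum cs

comb : ∀ {k} → List (Vec ℤ k) → List ℚ → Vec ℚ k
comb []       _        = qzero
comb (v ∷ vs) []       = qzero
comb (v ∷ vs) (c ∷ cs) = V.zipWith ℚ._+_ (V.map (c ℚ.*_) (toQv v)) (comb vs cs)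

-- An integral convex polytope R ⊂ ℝ^k is presented as conv(vs) for a finite
-- list vs of integer points.  x ∈ t·R  (t ≥ 0 rational, x rational) iff x is a
-- nonnegative combination of vs with coefficient sum t.
InScaled : ∀ {k} → ℚ → List (Vec ℤ k) → Vec ℚ k → Set
InScaled t vs x =
  Σ (List ℚ) λ cs → length cs ≡ length vs × LA.All (0ℚ ℚ.≤_) cs
                    × qsum cs ≡ t × comb vs cs ≡ x

LatticePt : ∀ {k} → List (Vec ℤ k) → ℕ → Vec ℤ k → Set
LatticePt vs n γ = InScaled (natQ n) vs (toQv γ)

-- dim conv(vs) = k : the affine hull of vs is all of ℚ^k (equivalently ℝ^k)
FullDim : ∀ {k} → List (Vec ℤ k) → Set
FullDim {k} vs = (x : Vec ℚ k) →
  Σ (List ℚ) λ cs → length cs ≡ length vs × qsum cs ≡ 1ℚ × comb vs cs ≡ x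

μ : ∀ {d} e → Vec ℤ d → Vec ℤ (d ℕ.+ e)
μ e α = α V.++ replicate e (+ 0)

ν : ∀ d {e} → Vec ℤ e → Vec ℤ (d ℕ.+ e)
ν d β = replicate d (+ 0) V.++ β

-- P ⊕ Q = conv(μ(P) ∪ ν(Q)) = conv(μ(vs) ∪ ν(ws))
freeSum : ∀ {d e} → List (Vec ℤ d) → List (Vec ℤ e) → List (Vec ℤ (d ℕ.+ e))
freeSum {d} {e} vs ws = L.map (μ e) vs L.++ L.map (ν d) ws

vsumℤ : ∀ {m n} → Vec (Vec ℤ m) n → Vec ℤ m
vsumℤ []       = replicate _ (+ 0)
vsumℤ (g ∷ gs) = V.zipWith ℤ._+_ g (vsumℤ gs)

SumOf : ∀ {m} → (Vec ℤ m → Set) → ℕ → Vec ℤ m → Set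
SumOf {m} S n γ = Σ (Vec (Vec ℤ m) n) λ gs → VA.All S gs × vsumℤ gs ≡ γ

Config : ∀ {k} → List (Vec ℤ k) → Vec ℤ (suc k) → Set
Config vs c = Σ _ λ α → LatticePt vs 1 α × c ≡ α ∷ʳ (+ 1)

HasSize : ∀ {A : Set} → (A → Set) → ℕ → Set
HasSize {A} P m = Σ (List A) λ l → Unique l × length l ≡ m
                    × ((x : A) → (P x → x ∈ l) × (x ∈ l → P x))

-- H(K[C], n) = number of distinct monomials t^γ s^n that are products of n
-- generators = number of distinct sums of n elements of C
IsHilbertFn : ∀ {k} → List (Vec ℤ k) → (ℕ → ℕ) → Set
IsHilbertFn vs H = (n : ℕ) → HasSize (SumOf (Config vs) n) (H n)

IsEhrhartFn : ∀ {k} → List (Vec ℤ k) → (ℕ → ℕ) → Set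
IsEhrhartFn vs i = (n : ℕ) → HasSize (LatticePt vs n) (i n)

IDP : ∀ {k} → List (Vec ℤ k) → Set
IDP {k} vs = (n : ℕ) → 1 ℕ.≤ n → (γ : Vec ℤ k) → LatticePt vs n γ →
  SumOf (LatticePt vs 1) n γ

Series : Set
Series = ℕ → ℤ

oneMinusλ : Series → Series
oneMinusλ f zero    = f zero
oneMinusλ f (suc n) = f (suc n) ℤ.- f n

oneMinusλ^ : ℕ → Series → Series
oneMinusλ^ zero    f = f
oneMinusλ^ (suc m) f = oneMinusλ (oneMinusλ^ m f)

sumTo : ℕ → (ℕ → ℤ) → ℤ
sumTo zero    f = f zero
sumTo (suc n) f = sumTo n f ℤ.+ f (suc n)

_⊛_ : Series → Series → Series
(f ⊛ g) n = sumTo n (λ j → f j ℤ.* g (n ∸ j))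

hPoly : ℕ → (ℕ → ℕ) → Series
hPoly k H = oneMinusλ^ (suc k) (λ n → + H n)

δPoly : ℕ → (ℕ → ℕ) → Series
δPoly k i = oneMinusλ^ (suc k) series
  where
  series : Series
  series zero    = + 1
  series (suc n) = + i (suc n)

-- Let Aₙ ⊆ ℤᵈ be the set of sums of n lattice points of P, so that the Hilbert
-- function of K[𝒜] is n ↦ |Aₙ|; since 0 ∈ P these sets increase with n, and
-- likewise Bₙ for Q. By the hypothesis every lattice point of P ⊕ Q lies in
-- μ(P) or in ν(Q), so the sums of n of them are exactly the points a ++ b with
-- a ∈ Aᵢ, b ∈ Bⱼ and i + j = n. Counting this union of increasing products by
-- the level at which a first appears gives
--   H_{𝒜⊕ℬ}(n) = Σᵢ (|Aᵢ| − |Aᵢ₋₁|) · |B_{n−i}|   (|A₋₁| = 0),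
-- that is H_{𝒜⊕ℬ} = ((1 − λ) H_𝒜) · H_ℬ as power series, and multiplying by
-- (1 − λ)^{d+e+1} yields h(K[𝒜⊕ℬ]) = h(K[𝒜]) h(K[ℬ]).
-- If P ⊕ Q has the integer decomposition property, so do P and Q (project a
-- decomposition of μ(γ), resp. ν(γ)). For a polytope R with this property the
-- lattice points of nR are exactly the n-fold sums of lattice points of R, so
-- its Ehrhart and Hilbert functions agree for n ≥ 1, whence δ(R) = h(K[C_R]).

module Submission where

open import Defs
open import Data.Nat using (ℕ; _+_)
open import Data.Integer using (ℤ; +_)
open import Data.Vec using (Vec; replicate)
open import Data.List using (List)
open import Data.Product using (Σ; _×_)
open import Data.Sum using (_⊎_)
open import Relation.Binary.PropositionalEquality using (_≡_)

open import Algebra.Bundles using (CommutativeMonoid)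
open import Data.Nat as ℕ using (zero; suc; _*_; _∸_; _≤_; _≤′_; ≤′-refl; ≤′-step; z≤n; s≤s)
import Data.Nat.Properties as ℕ
import Data.Nat.Coprimality as Coprime
import Data.Integer as ℤ
import Data.Integer.Properties as ℤ
open import Data.Integer.Tactic.RingSolver using (solve-∀)
open import Algebra.Properties.Ring ℤ.+-*-ring using (x[y-z]≈xy-xz)
open import Data.Rational as ℚ using (ℚ; 0ℚ; mkℚ)
import Data.Rational.Properties as ℚ
open import Algebra.Properties.CommutativeSemigroup
  (CommutativeMonoid.commutativeSemigroup ℚ.+-0-commutativeMonoid) using (interchange)
open import Data.List as L using ([]; _∷_; length; filter; cartesianProduct)
import Data.List.Properties as L
open import Data.List.Membership.Propositional using (_∈_)
open import Data.List.Membership.Propositional.Properties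
  using (∈-map⁺; ∈-map⁻; ∈-++⁺ˡ; ∈-++⁺ʳ; ∈-++⁻; ∈-filter⁺; ∈-filter⁻;
         ∈-cartesianProduct⁺; ∈-cartesianProduct⁻)
open import Data.List.Membership.Propositional.Properties.WithK using (unique∧set⇒bag)
import Data.List.Membership.DecPropositional as DecMembership
open import Data.List.Relation.Binary.BagAndSetEquality using (∼bag⇒↭)
open import Data.List.Relation.Binary.Permutation.Propositional.Properties using (↭-length)
open import Data.List.Relation.Unary.All as ListAll using ([]; _∷_)
import Data.List.Relation.Unary.All.Properties as ListAll
open import Data.List.Relation.Unary.Any using (here; there)
open import Data.List.Relation.Unary.AllPairs using ([]; _∷_)
open import Data.List.Relation.Unary.Unique.Propositional using (Unique)
import Data.List.Relation.Unary.Unique.Propositional.Properties as Unique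
open import Data.Vec as V using ([]; _∷_; _∷ʳ_; _++_; zipWith; take; drop)
import Data.Vec.Properties as V
open import Data.Vec.Relation.Unary.All as VecAll using ([]; _∷_)
import Data.Vec.Relation.Unary.All.Properties as VecAll
open import Data.Product using (∃; _,_; proj₁; proj₂; uncurry)
open import Data.Sum using (inj₁; inj₂; [_,_])
open import Function using (_∘_; id; mk⇔)
open import Level using (0ℓ)
open import Relation.Binary.Definitions using (DecidableEquality)
open import Relation.Binary.PropositionalEquality
  using (refl; sym; trans; cong; cong₂; subst; _≗_; module ≡-Reasoning)
open import Relation.Nullary using (¬?; yes; no)
open import Relation.Nullary.Decidable using (map′)
open import Relation.Unary using (Pred; Decidable; _⊆_; _≐_; _∪_; _∩_; _∖_; _⟨×⟩_; _⊥_)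
open import Relation.Unary.Properties using (≐-sym)

private
  variable
    A B : Set
    k l m n : ℕ

-- Power series

private
  [a-b]+[c-d]≡[a+c]-[b+d] : ∀ a b c d → (a ℤ.- b) ℤ.+ (c ℤ.- d) ≡ (a ℤ.+ c) ℤ.- (b ℤ.+ d)
  [a-b]+[c-d]≡[a+c]-[b+d] = solve-∀

  [a+b]-c≡[a-c]+b : ∀ a b c → (a ℤ.+ b) ℤ.- c ≡ (a ℤ.- c) ℤ.+ b
  [a+b]-c≡[a-c]+b = solve-∀

  [a+b]-a≡b : ∀ a b → (a ℤ.+ b) ℤ.- a ≡ b
  [a+b]-a≡b = solve-∀

sumTo-cong : ∀ n {f g : ℕ → ℤ} → (∀ {j} → j ≤ n → f j ≡ g j) → sumTo n f ≡ sumTo n g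
sumTo-cong zero    f≡g = f≡g z≤n
sumTo-cong (suc n) f≡g = cong₂ ℤ._+_ (sumTo-cong n (f≡g ∘ ℕ.m≤n⇒m≤1+n)) (f≡g ℕ.≤-refl)

sumTo-unroll : ∀ n (f : ℕ → ℤ) → sumTo (suc n) f ≡ f 0 ℤ.+ sumTo n (f ∘ suc)
sumTo-unroll zero    f = refl
sumTo-unroll (suc n) f = begin
  sumTo (suc n) f ℤ.+ f (suc (suc n))             ≡⟨ cong (ℤ._+ f (suc (suc n))) (sumTo-unroll n f) ⟩
  (f 0 ℤ.+ sumTo n (f ∘ suc)) ℤ.+ f (suc (suc n)) ≡⟨ ℤ.+-assoc (f 0) _ _ ⟩
  f 0 ℤ.+ sumTo (suc n) (f ∘ suc)                 ∎
  where open ≡-Reasoning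

sumTo-reverse : ∀ n (f : ℕ → ℤ) → sumTo n f ≡ sumTo n (λ j → f (n ∸ j))
sumTo-reverse zero    f = refl
sumTo-reverse (suc n) f = begin
  sumTo n f ℤ.+ f (suc n)                 ≡⟨ cong (ℤ._+ f (suc n)) (sumTo-reverse n f) ⟩
  sumTo n (λ j → f (n ∸ j)) ℤ.+ f (suc n) ≡⟨ ℤ.+-comm _ (f (suc n)) ⟩
  f (suc n) ℤ.+ sumTo n (λ j → f (n ∸ j)) ≡⟨ sumTo-unroll n (λ j → f (suc n ∸ j)) ⟨
  sumTo (suc n) (λ j → f (suc n ∸ j))     ∎
  where open ≡-Reasoning

sumTo-minus : ∀ n (f g : ℕ → ℤ) → sumTo n (λ j → f j ℤ.- g j) ≡ sumTo n f ℤ.- sumTo n g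
sumTo-minus zero    f g = refl
sumTo-minus (suc n) f g = begin
  sumTo n (λ j → f j ℤ.- g j) ℤ.+ (f (suc n) ℤ.- g (suc n))
    ≡⟨ cong (ℤ._+ (f (suc n) ℤ.- g (suc n))) (sumTo-minus n f g) ⟩
  (sumTo n f ℤ.- sumTo n g) ℤ.+ (f (suc n) ℤ.- g (suc n))
    ≡⟨ [a-b]+[c-d]≡[a+c]-[b+d] (sumTo n f) (sumTo n g) (f (suc n)) (g (suc n)) ⟩
  (sumTo n f ℤ.+ f (suc n)) ℤ.- (sumTo n g ℤ.+ g (suc n)) ∎
  where open ≡-Reasoning

⊛-cong : ∀ {f f′ g g′ : Series} → f ≗ f′ → g ≗ g′ → f ⊛ g ≗ f′ ⊛ g′
⊛-cong f≗f′ g≗g′ n = sumTo-cong n (λ {j} _ → cong₂ ℤ._*_ (f≗f′ j) (g≗g′ (n ∸ j)))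

⊛-comm : ∀ (f g : Series) → f ⊛ g ≗ g ⊛ f
⊛-comm f g n = trans (sumTo-reverse n _) (sumTo-cong n swap)
  where
  swap : ∀ {j} → j ≤ n → f (n ∸ j) ℤ.* g (n ∸ (n ∸ j)) ≡ g j ℤ.* f (n ∸ j)
  swap {j} j≤n rewrite ℕ.m∸[m∸n]≡n j≤n = ℤ.*-comm (f (n ∸ j)) (g j)

oneMinusλ-cong : ∀ {f g : Series} → f ≗ g → oneMinusλ f ≗ oneMinusλ g
oneMinusλ-cong f≗g zero    = f≗g 0
oneMinusλ-cong f≗g (suc n) = cong₂ ℤ._-_ (f≗g (suc n)) (f≗g n)

oneMinusλ^-cong : ∀ k {f g : Series} → f ≗ g → oneMinusλ^ k f ≗ oneMinusλ^ k g
oneMinusλ^-cong zero    f≗g = f≗g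
oneMinusλ^-cong (suc k) f≗g = oneMinusλ-cong (oneMinusλ^-cong k f≗g)

oneMinusλ^-+ : ∀ a b (f : Series) → oneMinusλ^ (a + b) f ≗ oneMinusλ^ a (oneMinusλ^ b f)
oneMinusλ^-+ zero    b f _ = refl
oneMinusλ^-+ (suc a) b f   = oneMinusλ-cong (oneMinusλ^-+ a b f)

oneMinusλ^-suc : ∀ a (f : Series) → oneMinusλ^ a (oneMinusλ f) ≗ oneMinusλ^ (suc a) f
oneMinusλ^-suc a f n =
  trans (sym (oneMinusλ^-+ a 1 f n)) (cong (λ k → oneMinusλ^ k f n) (ℕ.+-comm a 1))

oneMinusλ-⊛ʳ : ∀ (f g : Series) → oneMinusλ (f ⊛ g) ≗ f ⊛ oneMinusλ g
oneMinusλ-⊛ʳ f g zero    = refl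
oneMinusλ-⊛ʳ f g (suc m) = begin
  (S₁ ℤ.+ f (suc m) ℤ.* g (m ∸ m)) ℤ.- S₀
    ≡⟨ cong (λ k → (S₁ ℤ.+ f (suc m) ℤ.* g k) ℤ.- S₀) (ℕ.n∸n≡0 m) ⟩
  (S₁ ℤ.+ f (suc m) ℤ.* g 0) ℤ.- S₀
    ≡⟨ [a+b]-c≡[a-c]+b S₁ (f (suc m) ℤ.* g 0) S₀ ⟩
  (S₁ ℤ.- S₀) ℤ.+ f (suc m) ℤ.* g 0
    ≡⟨ cong (ℤ._+ f (suc m) ℤ.* g 0) (sumTo-minus m _ _) ⟨
  sumTo m (λ j → f j ℤ.* g (suc m ∸ j) ℤ.- f j ℤ.* g (m ∸ j)) ℤ.+ f (suc m) ℤ.* g 0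
    ≡⟨ cong₂ ℤ._+_ (sumTo-cong m term) (cong (λ k → f (suc m) ℤ.* oneMinusλ g k) (ℕ.n∸n≡0 m)) ⟨
  sumTo m (λ j → f j ℤ.* oneMinusλ g (suc m ∸ j)) ℤ.+ f (suc m) ℤ.* oneMinusλ g (m ∸ m) ∎
  where
  open ≡-Reasoning
  S₁ S₀ : ℤ
  S₁ = sumTo m (λ j → f j ℤ.* g (suc m ∸ j))
  S₀ = sumTo m (λ j → f j ℤ.* g (m ∸ j))
  term : ∀ {j} → j ≤ m → f j ℤ.* oneMinusλ g (suc m ∸ j) ≡ f j ℤ.* g (suc m ∸ j) ℤ.- f j ℤ.* g (m ∸ j)
  term {j} j≤m rewrite ℕ.+-∸-assoc 1 j≤m = x[y-z]≈xy-xz (f j) _ _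

oneMinusλ^-⊛ʳ : ∀ k (f g : Series) → oneMinusλ^ k (f ⊛ g) ≗ f ⊛ oneMinusλ^ k g
oneMinusλ^-⊛ʳ zero    f g n = refl
oneMinusλ^-⊛ʳ (suc k) f g n =
  trans (oneMinusλ-cong (oneMinusλ^-⊛ʳ k f g) n) (oneMinusλ-⊛ʳ f (oneMinusλ^ k g) n)

oneMinusλ^-⊛ˡ : ∀ k (f g : Series) → oneMinusλ^ k (f ⊛ g) ≗ oneMinusλ^ k f ⊛ g
oneMinusλ^-⊛ˡ k f g n = begin
  oneMinusλ^ k (f ⊛ g) n   ≡⟨ oneMinusλ^-cong k (⊛-comm f g) n ⟩
  oneMinusλ^ k (g ⊛ f) n   ≡⟨ oneMinusλ^-⊛ʳ k g f n ⟩
  (g ⊛ oneMinusλ^ k f) n   ≡⟨ ⊛-comm g (oneMinusλ^ k f) n ⟩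
  (oneMinusλ^ k f ⊛ g) n   ∎
  where open ≡-Reasoning

oneMinusλ^-⊛ : ∀ a b (f g : Series) → oneMinusλ^ (a + b) (f ⊛ g) ≗ oneMinusλ^ a f ⊛ oneMinusλ^ b g
oneMinusλ^-⊛ a b f g n = begin
  oneMinusλ^ (a + b) (f ⊛ g) n          ≡⟨ oneMinusλ^-+ a b (f ⊛ g) n ⟩
  oneMinusλ^ a (oneMinusλ^ b (f ⊛ g)) n ≡⟨ oneMinusλ^-cong a (oneMinusλ^-⊛ʳ b f g) n ⟩
  oneMinusλ^ a (f ⊛ oneMinusλ^ b g) n   ≡⟨ oneMinusλ^-⊛ˡ a f (oneMinusλ^ b g) n ⟩
  (oneMinusλ^ a f ⊛ oneMinusλ^ b g) n   ∎
  where open ≡-Reasoning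

ofℕ : (ℕ → ℕ) → Series
ofℕ H n = + H n

hPoly-⊛ : ∀ d e {HA HB HAB : ℕ → ℕ} → ofℕ HAB ≗ oneMinusλ (ofℕ HA) ⊛ ofℕ HB →
  hPoly (d + e) HAB ≗ hPoly d HA ⊛ hPoly e HB
hPoly-⊛ d e {HA} {HB} {HAB} HAB≗ n = begin
  oneMinusλ^ (suc (d + e)) (ofℕ HAB) n
    ≡⟨ oneMinusλ^-cong (suc (d + e)) HAB≗ n ⟩
  oneMinusλ^ (suc (d + e)) (oneMinusλ (ofℕ HA) ⊛ ofℕ HB) n
    ≡⟨ cong (λ k → oneMinusλ^ k (oneMinusλ (ofℕ HA) ⊛ ofℕ HB) n) (ℕ.+-suc d e) ⟨
  oneMinusλ^ (d + suc e) (oneMinusλ (ofℕ HA) ⊛ ofℕ HB) n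
    ≡⟨ oneMinusλ^-⊛ d (suc e) (oneMinusλ (ofℕ HA)) (ofℕ HB) n ⟩
  (oneMinusλ^ d (oneMinusλ (ofℕ HA)) ⊛ hPoly e HB) n
    ≡⟨ ⊛-cong {g = hPoly e HB} (oneMinusλ^-suc d (ofℕ HA)) (λ _ → refl) n ⟩
  (hPoly d HA ⊛ hPoly e HB) n ∎
  where open ≡-Reasoning

δPoly≗hPoly : ∀ k {i H : ℕ → ℕ} → H 0 ≡ 1 → (∀ n → i (suc n) ≡ H (suc n)) → δPoly k i ≗ hPoly k H
δPoly≗hPoly k H0≡1 i≗H =
  oneMinusλ^-cong (suc k) λ { zero → cong +_ (sym H0≡1) ; (suc n) → cong +_ (i≗H n) }

-- Finite sets

HasSize-unique : {P : Pred A _} → HasSize P m → HasSize P n → m ≡ n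
HasSize-unique (l , l! , refl , l≐P) (l′ , l′! , refl , l′≐P) =
  ↭-length (∼bag⇒↭ (unique∧set⇒bag l! l′! λ {x} →
    mk⇔ (proj₁ (l′≐P x) ∘ proj₂ (l≐P x)) (proj₁ (l≐P x) ∘ proj₂ (l′≐P x))))

HasSize-resp : {P Q : Pred A _} → P ≐ Q → HasSize P m → HasSize Q m
HasSize-resp (P⊆Q , Q⊆P) (l , l! , |l| , l≐P) =
  l , l! , |l| , λ x → proj₁ (l≐P x) ∘ Q⊆P , P⊆Q ∘ proj₂ (l≐P x)

HasSize-singleton : (x : A) → HasSize (x ≡_) 1
HasSize-singleton x =
  x ∷ [] , [] ∷ [] , refl , λ y → (λ { refl → here refl }) , (λ { (here refl) → refl })

HasSize-decidable : {P : Pred A _} → DecidableEquality A → HasSize P m → Decidable P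
HasSize-decidable _≟_ (l , _ , _ , l≐P) x = map′ (proj₂ (l≐P x)) (proj₁ (l≐P x)) (x ∈? l)
  where open DecMembership _≟_ using (_∈?_)

HasSize-∪ : {P Q : Pred A _} → P ⊥ Q → HasSize P m → HasSize Q n → HasSize (P ∪ Q) (m + n)
HasSize-∪ P⊥Q (l , l! , refl , l≐P) (l′ , l′! , refl , l′≐Q) =
  l L.++ l′ ,
  Unique.++⁺ l! l′! (λ (x∈l , x∈l′) → P⊥Q (proj₂ (l≐P _) x∈l , proj₂ (l′≐Q _) x∈l′)) ,
  L.length-++ l ,
  λ x → [ ∈-++⁺ˡ ∘ proj₁ (l≐P x) , ∈-++⁺ʳ l ∘ proj₁ (l′≐Q x) ] ,
        [ inj₁ ∘ proj₂ (l≐P x) , inj₂ ∘ proj₂ (l′≐Q x) ] ∘ ∈-++⁻ l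

HasSize-∩ : {P Q : Pred A _} → Decidable Q → HasSize P m → ∃ λ n → HasSize (P ∩ Q) n
HasSize-∩ Q? (l , l! , _ , l≐P) =
  _ , filter Q? l , Unique.filter⁺ Q? l! , refl ,
  λ x → (λ (Px , Qx) → ∈-filter⁺ Q? (proj₁ (l≐P x) Px) Qx) ,
        (λ x∈ → let x∈l , Qx = ∈-filter⁻ Q? x∈ in proj₂ (l≐P x) x∈l , Qx)

HasSize-∖ : {P Q : Pred A _} → DecidableEquality A → P ⊆ Q → HasSize P m → HasSize Q n →
  ∃ λ r → HasSize (Q ∖ P) r × m + r ≡ n
HasSize-∖ {P = P} {Q} _≟_ P⊆Q |P| |Q| =
  let r , |Q∖P| = HasSize-∩ (¬? ∘ P?) |Q|
  in r , |Q∖P| ,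
     HasSize-unique (HasSize-resp P∪[Q∖P]≐Q (HasSize-∪ (λ (Px , _ , ¬Px) → ¬Px Px) |P| |Q∖P|)) |Q|
  where
  P? : Decidable P
  P? = HasSize-decidable _≟_ |P|
  Q⊆P∪[Q∖P] : Q ⊆ P ∪ (Q ∖ P)
  Q⊆P∪[Q∖P] {x} Qx with P? x
  ... | yes Px  = inj₁ Px
  ... | no  ¬Px = inj₂ (Qx , ¬Px)
  P∪[Q∖P]≐Q : P ∪ (Q ∖ P) ≐ Q
  P∪[Q∖P]≐Q = [ P⊆Q , proj₁ ] , Q⊆P∪[Q∖P]

length-cartesianProduct : (xs : List A) (ys : List B) →
  length (cartesianProduct xs ys) ≡ length xs * length ys
length-cartesianProduct []       ys = refl
length-cartesianProduct (x ∷ xs) ys = begin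
  length (L.map (x ,_) ys L.++ cartesianProduct xs ys)
    ≡⟨ L.length-++ (L.map (x ,_) ys) ⟩
  length (L.map (x ,_) ys) + length (cartesianProduct xs ys)
    ≡⟨ cong₂ _+_ (L.length-map (x ,_) ys) (length-cartesianProduct xs ys) ⟩
  length ys + length xs * length ys ∎
  where open ≡-Reasoning

HasSize-⟨×⟩ : {P : Pred A _} {Q : Pred B _} → HasSize P m → HasSize Q n → HasSize (P ⟨×⟩ Q) (m * n)
HasSize-⟨×⟩ (l , l! , refl , l≐P) (l′ , l′! , refl , l′≐Q) =
  cartesianProduct l l′ , Unique.cartesianProduct⁺ l! l′! , length-cartesianProduct l l′ ,
  λ (x , y) →
    (λ (Px , Qy) → ∈-cartesianProduct⁺ (proj₁ (l≐P x) Px) (proj₁ (l′≐Q y) Qy)) ,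
    (λ xy∈ → let x∈l , y∈l′ = ∈-cartesianProduct⁻ l l′ xy∈
             in proj₂ (l≐P x) x∈l , proj₂ (l′≐Q y) y∈l′)

unique-map⁺ : (f : A → B) {l : List A} → (∀ {x y} → x ∈ l → y ∈ l → f x ≡ f y → x ≡ y) →
  Unique l → Unique (L.map f l)
unique-map⁺ f inj []        = []
unique-map⁺ f inj (x∉ ∷ l!) =
  ListAll.map⁺ (ListAll.tabulate λ y∈l fx≡fy →
    ListAll.lookup x∉ y∈l (inj (here refl) (there y∈l) fx≡fy))
  ∷ unique-map⁺ f (λ x∈ y∈ → inj (there x∈) (there y∈)) l!

HasSize-image : {P : Pred A _} {Q : Pred B _} (f : A → B) →
  (∀ {x y} → P x → P y → f x ≡ f y → x ≡ y) →
  (∀ {x} → P x → Q (f x)) → (∀ {y} → Q y → ∃ λ x → P x × y ≡ f x) →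
  HasSize P m → HasSize Q m
HasSize-image {Q = Q} f inj f[P]⊆Q Q⊆f[P] (l , l! , |l| , l≐P) =
  L.map f l ,
  unique-map⁺ f (λ x∈ y∈ → inj (proj₂ (l≐P _) x∈) (proj₂ (l≐P _) y∈)) l! ,
  trans (L.length-map f l) |l| ,
  λ y → (λ Qy → let x , Px , y≡fx = Q⊆f[P] Qy
                in subst (_∈ L.map f l) (sym y≡fx) (∈-map⁺ f (proj₁ (l≐P x) Px))) ,
        (λ y∈ → let x , x∈l , y≡fx = ∈-map⁻ f y∈
                in subst Q (sym y≡fx) (f[P]⊆Q (proj₂ (l≐P x) x∈l)))

⊆-mono-≤′ : {P : ℕ → Pred A 0ℓ} → (∀ i → P i ⊆ P (suc i)) → ∀ {i j} → i ≤′ j → P i ⊆ P j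
⊆-mono-≤′ P-mono ≤′-refl       = id
⊆-mono-≤′ P-mono (≤′-step i≤j) = P-mono _ ∘ ⊆-mono-≤′ P-mono i≤j

⊆-mono-≤ : {P : ℕ → Pred A 0ℓ} → (∀ i → P i ⊆ P (suc i)) → ∀ {i j} → i ≤ j → P i ⊆ P j
⊆-mono-≤ P-mono = ⊆-mono-≤′ P-mono ∘ ℕ.≤⇒≤′

Antidiagonal : ∀ {X Y : Set} → (ℕ → Pred X 0ℓ) → (ℕ → Pred Y 0ℓ) → ℕ → Pred (X × Y) 0ℓ
Antidiagonal A B n (x , y) = ∃ λ i → ∃ λ j → i + j ≡ n × A i x × B j y

module Chains {X Y : Set} (_≟_ : DecidableEquality X)
  (A : ℕ → Pred X 0ℓ) (B : ℕ → Pred Y 0ℓ) {a b : ℕ → ℕ}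
  (|A| : ∀ i → HasSize (A i) (a i)) (|B| : ∀ j → HasSize (B j) (b j))
  (A-mono : ∀ i → A i ⊆ A (suc i)) (B-mono : ∀ j → B j ⊆ B (suc j)) where

  Below : ℕ → ℕ → Pred (X × Y) 0ℓ
  Below n k (x , y) = ∃ λ i → i ≤ k × A i x × B (n ∸ i) y

  Antidiagonal≐Below : ∀ n → Antidiagonal A B n ≐ Below n n
  Antidiagonal≐Below n =
    (λ { (i , j , refl , Ax , By) →
           i , ℕ.m≤m+n i j , Ax , subst (λ k → B k _) (sym (ℕ.m+n∸m≡n i j)) By }) ,
    (λ { (i , i≤n , Ax , By) → i , n ∸ i , ℕ.m+[n∸m]≡n i≤n , Ax , By })

  growth : ∀ i → ∃ λ r → HasSize (A (suc i) ∖ A i) r × + r ≡ oneMinusλ (ofℕ a) (suc i)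
  growth i =
    let r , |A[1+i]∖A[i]| , a[i]+r≡a[1+i] = HasSize-∖ _≟_ (A-mono i) (|A| i) (|A| (suc i))
    in r , |A[1+i]∖A[i]| , (begin
      + r                       ≡⟨ [a+b]-a≡b (+ a i) (+ r) ⟨
      (+ a i ℤ.+ + r) ℤ.- + a i ≡⟨ cong (ℤ._- + a i) (ℤ.pos-+ (a i) r) ⟨
      + (a i + r) ℤ.- + a i     ≡⟨ cong (λ t → + t ℤ.- + a i) a[i]+r≡a[1+i] ⟩
      + a (suc i) ℤ.- + a i     ∎)
    where open ≡-Reasoning

  -- A pair at level k + 1 whose first component already lies in A k also occurs
  -- at level k, because B (n ∸ suc k) ⊆ B (n ∸ k).
  Below-suc : ∀ n k → Below n (suc k) ≐ Below n k ∪ ((A (suc k) ∖ A k) ⟨×⟩ B (n ∸ suc k))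
  Below-suc n k =
    split ,
    [ (λ (i , i≤k , Ax , By) → i , ℕ.m≤n⇒m≤1+n i≤k , Ax , By)
    , (λ ((Ax , _) , By) → suc k , ℕ.≤-refl , Ax , By) ]
    where
    split : Below n (suc k) ⊆ Below n k ∪ ((A (suc k) ∖ A k) ⟨×⟩ B (n ∸ suc k))
    split {x , y} (i , i≤1+k , Ax , By) with ℕ.m≤n⇒m<n∨m≡n i≤1+k
    ... | inj₁ (s≤s i≤k) = inj₁ (i , i≤k , Ax , By)
    ... | inj₂ refl with HasSize-decidable _≟_ (|A| k) x
    ...   | yes Akx = inj₁ (k , ℕ.≤-refl , Akx , ⊆-mono-≤ B-mono (ℕ.∸-monoʳ-≤ n (ℕ.n≤1+n k)) By)
    ...   | no ¬Akx = inj₂ ((Ax , ¬Akx) , By)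

  |Below| : ∀ n k → ∃ λ s → HasSize (Below n k) s ×
    + s ≡ sumTo k (λ i → oneMinusλ (ofℕ a) i ℤ.* + b (n ∸ i))
  |Below| n zero =
    a 0 * b n ,
    HasSize-resp ((λ (Ax , By) → 0 , z≤n , Ax , By) , (λ { (0 , z≤n , Ax , By) → Ax , By }))
                 (HasSize-⟨×⟩ (|A| 0) (|B| n)) ,
    ℤ.pos-* (a 0) (b n)
  |Below| n (suc k) =
    let s , |Below[k]| , +s≡ = |Below| n k
        r , |A[1+k]∖A[k]| , +r≡ = growth k
    in s + r * b (n ∸ suc k) ,
       HasSize-resp (≐-sym (Below-suc n k))
         (HasSize-∪ disjoint |Below[k]| (HasSize-⟨×⟩ |A[1+k]∖A[k]| (|B| (n ∸ suc k)))) ,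
       (begin
         + (s + r * b (n ∸ suc k))
           ≡⟨ ℤ.pos-+ s _ ⟩
         + s ℤ.+ + (r * b (n ∸ suc k))
           ≡⟨ cong₂ ℤ._+_ +s≡ (trans (ℤ.pos-* r _) (cong (ℤ._* + b (n ∸ suc k)) +r≡)) ⟩
         sumTo (suc k) (λ i → oneMinusλ (ofℕ a) i ℤ.* + b (n ∸ i)) ∎)
    where
    open ≡-Reasoning
    disjoint : Below n k ⊥ ((A (suc k) ∖ A k) ⟨×⟩ B (n ∸ suc k))
    disjoint ((i , i≤k , Ax , _) , (_ , ¬Akx) , _) = ¬Akx (⊆-mono-≤ A-mono i≤k Ax)

  |Antidiagonal| : ∀ n → ∃ λ s → HasSize (Antidiagonal A B n) s ×
    + s ≡ (oneMinusλ (ofℕ a) ⊛ ofℕ b) n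
  |Antidiagonal| n =
    let s , |Below[n]| , +s≡ = |Below| n n
    in s , HasSize-resp (≐-sym (Antidiagonal≐Below n)) |Below[n]| , +s≡

-- Sums of integer vectors

infixl 6 _+ᵥ_
_+ᵥ_ : Vec ℤ k → Vec ℤ k → Vec ℤ k
_+ᵥ_ = zipWith ℤ._+_

0ᵥ : Vec ℤ k
0ᵥ = replicate _ (+ 0)

+ᵥ-identityˡ : (x : Vec ℤ k) → 0ᵥ +ᵥ x ≡ x
+ᵥ-identityˡ = V.zipWith-identityˡ ℤ.+-identityˡ

+ᵥ-identityʳ : (x : Vec ℤ k) → x +ᵥ 0ᵥ ≡ x
+ᵥ-identityʳ = V.zipWith-identityʳ ℤ.+-identityʳ

+ᵥ-assoc : (x y z : Vec ℤ k) → (x +ᵥ y) +ᵥ z ≡ x +ᵥ (y +ᵥ z)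
+ᵥ-assoc = V.zipWith-assoc ℤ.+-assoc

replicate-++ : ∀ m n (a : A) → replicate (m + n) a ≡ replicate m a ++ replicate n a
replicate-++ zero    n a = refl
replicate-++ (suc m) n a = cong (a ∷_) (replicate-++ m n a)

replicate-∷ʳ : ∀ n (a : A) → replicate (suc n) a ≡ replicate n a ∷ʳ a
replicate-∷ʳ zero    a = refl
replicate-∷ʳ (suc n) a = cong (a ∷_) (replicate-∷ʳ n a)

zipWith-∷ʳ : ∀ {C : Set} (f : A → B → C) (xs : Vec A n) (ys : Vec B n) a b →
  zipWith f (xs ∷ʳ a) (ys ∷ʳ b) ≡ zipWith f xs ys ∷ʳ f a b
zipWith-∷ʳ f []       []       a b = refl
zipWith-∷ʳ f (x ∷ xs) (y ∷ ys) a b = cong (f x y ∷_) (zipWith-∷ʳ f xs ys a b)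

vsumℤ-++ : (gs : Vec (Vec ℤ k) m) (hs : Vec (Vec ℤ k) n) → vsumℤ (gs ++ hs) ≡ vsumℤ gs +ᵥ vsumℤ hs
vsumℤ-++ []       hs = sym (+ᵥ-identityˡ (vsumℤ hs))
vsumℤ-++ (g ∷ gs) hs = trans (cong (g +ᵥ_) (vsumℤ-++ gs hs)) (sym (+ᵥ-assoc g (vsumℤ gs) (vsumℤ hs)))

Additive : (Vec ℤ k → Vec ℤ l) → Set
Additive f = f 0ᵥ ≡ 0ᵥ × (∀ x y → f (x +ᵥ y) ≡ f x +ᵥ f y)

vsumℤ-map : {f : Vec ℤ k → Vec ℤ l} → Additive f → (gs : Vec (Vec ℤ k) n) →
  f (vsumℤ gs) ≡ vsumℤ (V.map f gs)
vsumℤ-map (f0 , f+) []       = f0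
vsumℤ-map (f0 , f+) (g ∷ gs) = trans (f+ g (vsumℤ gs)) (cong (_ +ᵥ_) (vsumℤ-map (f0 , f+) gs))

module _ {S : Pred (Vec ℤ k) 0ℓ} where

  SumOf-zero : SumOf S 0 ≐ (0ᵥ ≡_)
  SumOf-zero = (λ { ([] , [] , 0≡x) → 0≡x }) , (λ { refl → [] , [] , refl })

  SumOf-∷ : ∀ {α x} → S α → SumOf S n x → SumOf S (suc n) (α +ᵥ x)
  SumOf-∷ Sα (gs , S[gs] , refl) = _ ∷ gs , Sα ∷ S[gs] , refl

  SumOf-+ : ∀ {x y} → SumOf S m x → SumOf S n y → SumOf S (m + n) (x +ᵥ y)
  SumOf-+ (gs , S[gs] , refl) (hs , S[hs] , refl) = gs ++ hs , VecAll.++⁺ S[gs] S[hs] , vsumℤ-++ gs hs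

  SumOf-mono : S 0ᵥ → SumOf S n ⊆ SumOf S (suc n)
  SumOf-mono S0 {x} Σx = subst (SumOf S _) (+ᵥ-identityˡ x) (SumOf-∷ S0 Σx)

  SumOf-map : {T : Pred (Vec ℤ l) 0ℓ} {f : Vec ℤ k → Vec ℤ l} → Additive f → (∀ {x} → S x → T (f x)) →
    ∀ {x} → SumOf S n x → SumOf T n (f x)
  SumOf-map f-additive S⇒T (gs , S[gs] , refl) =
    V.map _ gs , VecAll.map⁺ (VecAll.map S⇒T S[gs]) , sym (vsumℤ-map f-additive gs)

AtHeightOne : Pred (Vec ℤ k) 0ℓ → Pred (Vec ℤ (suc k)) 0ℓ
AtHeightOne S c = Σ _ λ α → S α × c ≡ α ∷ʳ + 1

module _ {S : Pred (Vec ℤ k) 0ℓ} where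

  SumOf-AtHeightOne⁺ : ∀ {a} → SumOf S n a → SumOf (AtHeightOne S) n (a ∷ʳ + n)
  SumOf-AtHeightOne⁺ ([] , [] , refl) = [] , [] , replicate-∷ʳ _ (+ 0)
  SumOf-AtHeightOne⁺ {suc n} (g ∷ gs , Sg ∷ S[gs] , refl) =
    let hs , H[hs] , Σhs≡ = SumOf-AtHeightOne⁺ (gs , S[gs] , refl)
    in (g ∷ʳ + 1) ∷ hs , (g , Sg , refl) ∷ H[hs] ,
       trans (cong ((g ∷ʳ + 1) +ᵥ_) Σhs≡) (zipWith-∷ʳ ℤ._+_ g (vsumℤ gs) (+ 1) (+ n))

  SumOf-AtHeightOne⁻ : ∀ {c} → SumOf (AtHeightOne S) n c → ∃ λ a → SumOf S n a × c ≡ a ∷ʳ + n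
  SumOf-AtHeightOne⁻ ([] , [] , refl) = 0ᵥ , ([] , [] , refl) , replicate-∷ʳ _ (+ 0)
  SumOf-AtHeightOne⁻ {suc n} (_ ∷ hs , (α , Sα , refl) ∷ H[hs] , refl) =
    let a , Σa , Σhs≡ = SumOf-AtHeightOne⁻ (hs , H[hs] , refl)
    in α +ᵥ a , SumOf-∷ Sα Σa ,
       trans (cong ((α ∷ʳ + 1) +ᵥ_) Σhs≡) (zipWith-∷ʳ ℤ._+_ α a (+ 1) (+ n))

  HasSize-SumOf-AtHeightOne : HasSize (SumOf (AtHeightOne S) n) m → HasSize (SumOf S n) m
  HasSize-SumOf-AtHeightOne {n} = HasSize-image V.init injective init-sum sum-init
    where
    injective : ∀ {c c′} → SumOf (AtHeightOne S) n c → SumOf (AtHeightOne S) n c′ →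
      V.init c ≡ V.init c′ → c ≡ c′
    injective Σc Σc′ eq with SumOf-AtHeightOne⁻ Σc | SumOf-AtHeightOne⁻ Σc′
    ... | a , _ , refl | a′ , _ , refl =
      cong (_∷ʳ + n) (trans (sym (V.init-∷ʳ (+ n) a)) (trans eq (V.init-∷ʳ (+ n) a′)))
    init-sum : ∀ {c} → SumOf (AtHeightOne S) n c → SumOf S n (V.init c)
    init-sum Σc with SumOf-AtHeightOne⁻ Σc
    ... | a , Σa , refl = subst (SumOf S n) (sym (V.init-∷ʳ (+ n) a)) Σa
    sum-init : ∀ {a} → SumOf S n a → ∃ λ c → SumOf (AtHeightOne S) n c × a ≡ V.init c
    sum-init {a} Σa = a ∷ʳ + n , SumOf-AtHeightOne⁺ Σa , sym (V.init-∷ʳ (+ n) a)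

-- Lattice points of dilated polytopes

-- z / 1 normalises to mkℚ z 0 _, on which ℚ._+_ computes.
toQ-+ : ∀ a b → toQ (a ℤ.+ b) ≡ toQ a ℚ.+ toQ b
toQ-+ a b = sym (trans (cong₂ ℚ._+_ (toQ≡mkℚ a) (toQ≡mkℚ b))
                       (cong (ℚ._/ 1) (cong₂ ℤ._+_ (ℤ.*-identityʳ a) (ℤ.*-identityʳ b))))
  where
  toQ≡mkℚ : ∀ z → toQ z ≡ mkℚ z 0 (Coprime.sym (Coprime.1-coprimeTo ℤ.∣ z ∣))
  toQ≡mkℚ z = ℚ.↥p/↧p≡p (mkℚ z 0 (Coprime.sym (Coprime.1-coprimeTo ℤ.∣ z ∣)))

natQ-+ : ∀ m n → natQ (m + n) ≡ natQ m ℚ.+ natQ n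
natQ-+ m n = trans (cong toQ (ℤ.pos-+ m n)) (toQ-+ (+ m) (+ n))

infixl 6 _+ᵠ_
_+ᵠ_ : Vec ℚ k → Vec ℚ k → Vec ℚ k
_+ᵠ_ = zipWith ℚ._+_

infixl 7 _·_
_·_ : ℚ → Vec ℚ k → Vec ℚ k
c · x = V.map (c ℚ.*_) x

+ᵠ-identityˡ : (x : Vec ℚ k) → qzero +ᵠ x ≡ x
+ᵠ-identityˡ = V.zipWith-identityˡ ℚ.+-identityˡ

+ᵠ-identityʳ : (x : Vec ℚ k) → x +ᵠ qzero ≡ x
+ᵠ-identityʳ = V.zipWith-identityʳ ℚ.+-identityʳ

+ᵠ-assoc : (x y z : Vec ℚ k) → (x +ᵠ y) +ᵠ z ≡ x +ᵠ (y +ᵠ z)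
+ᵠ-assoc = V.zipWith-assoc ℚ.+-assoc

+ᵠ-interchange : (w x y z : Vec ℚ k) → (w +ᵠ x) +ᵠ (y +ᵠ z) ≡ (w +ᵠ y) +ᵠ (x +ᵠ z)
+ᵠ-interchange []      []      []      []      = refl
+ᵠ-interchange (a ∷ w) (b ∷ x) (c ∷ y) (d ∷ z) =
  cong₂ _∷_ (interchange a b c d) (+ᵠ-interchange w x y z)

·-distribʳ-+ : ∀ c d (x : Vec ℚ k) → (c ℚ.+ d) · x ≡ c · x +ᵠ d · x
·-distribʳ-+ c d []      = refl
·-distribʳ-+ c d (a ∷ x) = cong₂ _∷_ (ℚ.*-distribʳ-+ a c d) (·-distribʳ-+ c d x)

·-zeroˡ : (x : Vec ℚ k) → 0ℚ · x ≡ qzero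
·-zeroˡ []      = refl
·-zeroˡ (a ∷ x) = cong₂ _∷_ (ℚ.*-zeroˡ a) (·-zeroˡ x)

·-zeroʳ : ∀ c → c · qzero {k} ≡ qzero
·-zeroʳ c = trans (V.map-replicate (c ℚ.*_) 0ℚ _) (cong (replicate _) (ℚ.*-zeroʳ c))

toQv-+ᵥ : (x y : Vec ℤ k) → toQv (x +ᵥ y) ≡ toQv x +ᵠ toQv y
toQv-+ᵥ []      []      = refl
toQv-+ᵥ (a ∷ x) (b ∷ y) = cong₂ _∷_ (toQ-+ a b) (toQv-+ᵥ x y)

toQv-0ᵥ : toQv (0ᵥ {k}) ≡ qzero
toQv-0ᵥ = trans (V.map-replicate toQ (+ 0) _) (cong (replicate _) (ℚ.0/n≡0 1))

infixl 6 _+ᶜ_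
_+ᶜ_ : List ℚ → List ℚ → List ℚ
_+ᶜ_ = L.zipWith ℚ._+_

zeros : ℕ → List ℚ
zeros n = L.replicate n 0ℚ

length-+ᶜ : ∀ cs ds → length cs ≡ length ds → length (cs +ᶜ ds) ≡ length cs
length-+ᶜ []       []       _  = refl
length-+ᶜ (c ∷ cs) (d ∷ ds) eq = cong suc (length-+ᶜ cs ds (ℕ.suc-injective eq))

nonneg-+ᶜ : ∀ {cs ds} → ListAll.All (0ℚ ℚ.≤_) cs → ListAll.All (0ℚ ℚ.≤_) ds →
  ListAll.All (0ℚ ℚ.≤_) (cs +ᶜ ds)
nonneg-+ᶜ []           _            = []
nonneg-+ᶜ (_ ∷ _)      []           = []
nonneg-+ᶜ (c≥0 ∷ cs≥0) (d≥0 ∷ ds≥0) = ℚ.+-mono-≤ c≥0 d≥0 ∷ nonneg-+ᶜ cs≥0 ds≥0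

zeros-nonneg : ∀ n → ListAll.All (0ℚ ℚ.≤_) (zeros n)
zeros-nonneg n = ListAll.replicate⁺ n ℚ.≤-refl

qsum-+ᶜ : ∀ cs ds → length cs ≡ length ds → qsum (cs +ᶜ ds) ≡ qsum cs ℚ.+ qsum ds
qsum-+ᶜ []       []       _  = sym (ℚ.+-identityˡ 0ℚ)
qsum-+ᶜ (c ∷ cs) (d ∷ ds) eq =
  trans (cong ((c ℚ.+ d) ℚ.+_) (qsum-+ᶜ cs ds (ℕ.suc-injective eq))) (interchange c d _ _)

qsum-zeros : ∀ n → qsum (zeros n) ≡ 0ℚ
qsum-zeros zero    = refl
qsum-zeros (suc n) = trans (ℚ.+-identityˡ _) (qsum-zeros n)

qsum-++ : ∀ cs ds → qsum (cs L.++ ds) ≡ qsum cs ℚ.+ qsum ds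
qsum-++ []       ds = sym (ℚ.+-identityˡ _)
qsum-++ (c ∷ cs) ds = trans (cong (c ℚ.+_) (qsum-++ cs ds)) (sym (ℚ.+-assoc c _ _))

comb-+ᶜ : ∀ (vs : List (Vec ℤ k)) cs ds → length cs ≡ length ds →
  comb vs (cs +ᶜ ds) ≡ comb vs cs +ᵠ comb vs ds
comb-+ᶜ []       _        _        _  = sym (+ᵠ-identityˡ qzero)
comb-+ᶜ (v ∷ vs) []       []       _  = sym (+ᵠ-identityˡ qzero)
comb-+ᶜ (v ∷ vs) (c ∷ cs) (d ∷ ds) eq = begin
  (c ℚ.+ d) · toQv v +ᵠ comb vs (cs +ᶜ ds)
    ≡⟨ cong₂ _+ᵠ_ (·-distribʳ-+ c d (toQv v)) (comb-+ᶜ vs cs ds (ℕ.suc-injective eq)) ⟩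
  (c · toQv v +ᵠ d · toQv v) +ᵠ (comb vs cs +ᵠ comb vs ds)
    ≡⟨ +ᵠ-interchange (c · toQv v) (d · toQv v) (comb vs cs) (comb vs ds) ⟩
  (c · toQv v +ᵠ comb vs cs) +ᵠ (d · toQv v +ᵠ comb vs ds) ∎
  where open ≡-Reasoning

comb-zeros : ∀ (vs : List (Vec ℤ k)) n → comb vs (zeros n) ≡ qzero
comb-zeros []       n       = refl
comb-zeros (v ∷ vs) zero    = refl
comb-zeros (v ∷ vs) (suc n) =
  trans (cong₂ _+ᵠ_ (·-zeroˡ (toQv v)) (comb-zeros vs n)) (+ᵠ-identityˡ qzero)

comb-++ : ∀ (us vs : List (Vec ℤ k)) cs ds → length cs ≡ length us →
  comb (us L.++ vs) (cs L.++ ds) ≡ comb us cs +ᵠ comb vs ds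
comb-++ []       vs []       ds _  = sym (+ᵠ-identityˡ (comb vs ds))
comb-++ (u ∷ us) vs (c ∷ cs) ds eq =
  trans (cong (c · toQv u +ᵠ_) (comb-++ us vs cs ds (ℕ.suc-injective eq)))
        (sym (+ᵠ-assoc (c · toQv u) (comb us cs) (comb vs ds)))

LatticePt-+ : ∀ (vs : List (Vec ℤ k)) {m n x y} → LatticePt vs m x → LatticePt vs n y →
  LatticePt vs (m + n) (x +ᵥ y)
LatticePt-+ vs {m} {n} {x} {y} (cs , |cs| , cs≥0 , Σcs , comb-cs) (ds , |ds| , ds≥0 , Σds , comb-ds) =
  cs +ᶜ ds ,
  trans (length-+ᶜ cs ds |cs|≡|ds|) |cs| ,
  nonneg-+ᶜ cs≥0 ds≥0 ,
  trans (qsum-+ᶜ cs ds |cs|≡|ds|) (trans (cong₂ ℚ._+_ Σcs Σds) (sym (natQ-+ m n))) ,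
  trans (comb-+ᶜ vs cs ds |cs|≡|ds|) (trans (cong₂ _+ᵠ_ comb-cs comb-ds) (sym (toQv-+ᵥ x y)))
  where
  |cs|≡|ds| : length cs ≡ length ds
  |cs|≡|ds| = trans |cs| (sym |ds|)

LatticePt-0 : ∀ (vs : List (Vec ℤ k)) → LatticePt vs 0 0ᵥ
LatticePt-0 vs =
  zeros (length vs) , L.length-replicate (length vs) , zeros-nonneg (length vs) ,
  trans (qsum-zeros (length vs)) (sym (ℚ.0/n≡0 1)) ,
  trans (comb-zeros vs (length vs)) (sym toQv-0ᵥ)

Pts : List (Vec ℤ k) → Pred (Vec ℤ k) 0ℓ
Pts vs = LatticePt vs 1

SumOf⊆LatticePt : ∀ (vs : List (Vec ℤ k)) → SumOf (Pts vs) n ⊆ LatticePt vs n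
SumOf⊆LatticePt vs ([] , [] , refl) = LatticePt-0 vs
SumOf⊆LatticePt {n = suc n} vs (g ∷ gs , g∈P ∷ gs∈P , refl) =
  LatticePt-+ vs {1} {n} g∈P (SumOf⊆LatticePt vs (gs , gs∈P , refl))

LatticePt-++ˡ : ∀ (us vs : List (Vec ℤ k)) {n x} → LatticePt us n x → LatticePt (us L.++ vs) n x
LatticePt-++ˡ us vs {n} {x} (cs , |cs| , cs≥0 , Σcs , comb-cs) =
  cs L.++ zeros |vs| ,
  trans (L.length-++ cs) (trans (cong₂ _+_ |cs| (L.length-replicate |vs|)) (sym (L.length-++ us))) ,
  ListAll.++⁺ cs≥0 (zeros-nonneg |vs|) ,
  trans (qsum-++ cs (zeros |vs|)) (trans (cong₂ ℚ._+_ Σcs (qsum-zeros |vs|)) (ℚ.+-identityʳ (natQ n))) ,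
  trans (comb-++ us vs cs (zeros |vs|) |cs|)
        (trans (cong₂ _+ᵠ_ comb-cs (comb-zeros vs |vs|)) (+ᵠ-identityʳ (toQv x)))
  where
  |vs| : ℕ
  |vs| = length vs

LatticePt-++ʳ : ∀ (us vs : List (Vec ℤ k)) {n x} → LatticePt vs n x → LatticePt (us L.++ vs) n x
LatticePt-++ʳ us vs {n} {x} (cs , |cs| , cs≥0 , Σcs , comb-cs) =
  zeros |us| L.++ cs ,
  trans (L.length-++ (zeros |us|)) (trans (cong₂ _+_ (L.length-replicate |us|) |cs|) (sym (L.length-++ us))) ,
  ListAll.++⁺ (zeros-nonneg |us|) cs≥0 ,
  trans (qsum-++ (zeros |us|) cs) (trans (cong₂ ℚ._+_ (qsum-zeros |us|) Σcs) (ℚ.+-identityˡ (natQ n))) ,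
  trans (comb-++ us vs (zeros |us|) cs (L.length-replicate |us|))
        (trans (cong₂ _+ᵠ_ (comb-zeros us |us|) comb-cs) (+ᵠ-identityˡ (toQv x)))
  where
  |us| : ℕ
  |us| = length us

Linear : (Vec ℚ k → Vec ℚ l) → Set
Linear g = g qzero ≡ qzero × (∀ c x y → g (c · x +ᵠ y) ≡ c · g x +ᵠ g y)

comb-map : {f : Vec ℤ k → Vec ℤ l} {g : Vec ℚ k → Vec ℚ l} →
  (∀ v → toQv (f v) ≡ g (toQv v)) → Linear g → ∀ vs cs → comb (L.map f vs) cs ≡ g (comb vs cs)
comb-map f≈g (g0 , g-linear) []       cs       = sym g0
comb-map f≈g (g0 , g-linear) (v ∷ vs) []       = sym g0
comb-map f≈g (g0 , g-linear) (v ∷ vs) (c ∷ cs) =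
  trans (cong₂ (λ x y → c · x +ᵠ y) (f≈g v) (comb-map f≈g (g0 , g-linear) vs cs))
        (sym (g-linear c (toQv v) (comb vs cs)))

LatticePt-map : {f : Vec ℤ k → Vec ℤ l} {g : Vec ℚ k → Vec ℚ l} →
  (∀ v → toQv (f v) ≡ g (toQv v)) → Linear g →
  ∀ (vs : List (Vec ℤ k)) {n x} → LatticePt vs n x → LatticePt (L.map f vs) n (f x)
LatticePt-map {f = f} {g} f≈g g-linear vs {x = x} (cs , |cs| , cs≥0 , Σcs , comb-cs) =
  cs , trans |cs| (sym (L.length-map f vs)) , cs≥0 , Σcs ,
  trans (comb-map f≈g g-linear vs cs) (trans (cong g comb-cs) (sym (f≈g x)))

++-linear : ∀ c (x y : Vec ℚ m) (x′ y′ : Vec ℚ n) →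
  (c · x +ᵠ y) ++ (c · x′ +ᵠ y′) ≡ c · (x ++ x′) +ᵠ (y ++ y′)
++-linear c x y x′ y′ =
  trans (sym (V.zipWith-++ ℚ._+_ (c · x) (c · x′) y y′))
        (cong (_+ᵠ (y ++ y′)) (sym (V.map-++ (c ℚ.*_) x x′)))

c·qzero+ᵠqzero : ∀ c → c · qzero +ᵠ qzero ≡ qzero {k}
c·qzero+ᵠqzero c = trans (+ᵠ-identityʳ (c · qzero)) (·-zeroʳ c)

linear-++qzero : Linear {m} (_++ qzero {n})
linear-++qzero {m} {n} =
  sym (replicate-++ m n 0ℚ) ,
  λ c x y → trans (cong ((c · x +ᵠ y) ++_) (sym (c·qzero+ᵠqzero c))) (++-linear c x y qzero qzero)

linear-qzero++ : Linear {n} (qzero {m} ++_)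
linear-qzero++ {n} {m} =
  sym (replicate-++ m n 0ℚ) ,
  λ c x y → trans (cong (_++ (c · x +ᵠ y)) (sym (c·qzero+ᵠqzero c))) (++-linear c qzero qzero x y)

module _ {d e : ℕ} (vs : List (Vec ℤ d)) (ws : List (Vec ℤ e)) where

  LatticePt-μ : ∀ {n α} → LatticePt vs n α → LatticePt (freeSum vs ws) n (μ e α)
  LatticePt-μ {n} =
    LatticePt-++ˡ (L.map (μ e) vs) (L.map (ν d) ws) {n} ∘ LatticePt-map toQv-μ linear-++qzero vs {n}
    where
    toQv-μ : ∀ v → toQv (μ e v) ≡ toQv v ++ qzero
    toQv-μ v = trans (V.map-++ toQ v 0ᵥ) (cong (toQv v ++_) toQv-0ᵥ)

  LatticePt-ν : ∀ {n β} → LatticePt ws n β → LatticePt (freeSum vs ws) n (ν d β)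
  LatticePt-ν {n} =
    LatticePt-++ʳ (L.map (μ e) vs) (L.map (ν d) ws) {n} ∘ LatticePt-map toQv-ν linear-qzero++ ws {n}
    where
    toQv-ν : ∀ v → toQv (ν d v) ≡ qzero ++ toQv v
    toQv-ν v = trans (V.map-++ toQ 0ᵥ v) (cong (_++ toQv v) toQv-0ᵥ)

-- Hilbert and Ehrhart functions

-- Config vs unfolds to AtHeightOne (Pts vs).
sumset-size : ∀ (vs : List (Vec ℤ k)) {H} → IsHilbertFn vs H → ∀ n → HasSize (SumOf (Pts vs) n) (H n)
sumset-size vs hH n = HasSize-SumOf-AtHeightOne (hH n)

hilbert-zero : ∀ (vs : List (Vec ℤ k)) {H} → IsHilbertFn vs H → H 0 ≡ 1
hilbert-zero vs hH =
  HasSize-unique (sumset-size vs hH 0) (HasSize-resp (≐-sym SumOf-zero) (HasSize-singleton 0ᵥ))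

ehrhart≡hilbert : ∀ (vs : List (Vec ℤ k)) {H i} → IDP vs → IsHilbertFn vs H → IsEhrhartFn vs i →
  ∀ n → i (suc n) ≡ H (suc n)
ehrhart≡hilbert vs idp hH hE n =
  HasSize-unique (HasSize-resp (idp (suc n) (s≤s z≤n) _ , SumOf⊆LatticePt vs) (hE (suc n)))
                 (sumset-size vs hH (suc n))

IDP⇒δPoly≗hPoly : ∀ (vs : List (Vec ℤ k)) {H i} → IDP vs → IsHilbertFn vs H → IsEhrhartFn vs i →
  δPoly k i ≗ hPoly k H
IDP⇒δPoly≗hPoly {k} vs idp hH hE = δPoly≗hPoly k (hilbert-zero vs hH) (ehrhart≡hilbert vs idp hH hE)

-- Free sums

take-++ : (xs : Vec A m) (ys : Vec A n) → take m (xs ++ ys) ≡ xs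
take-++ {m = m} xs ys = V.++-injectiveˡ (take m (xs ++ ys)) xs (V.take++drop≡id m (xs ++ ys))

drop-++ : (xs : Vec A m) (ys : Vec A n) → drop m (xs ++ ys) ≡ ys
drop-++ {m = m} xs ys = V.++-injectiveʳ (take m (xs ++ ys)) xs (V.take++drop≡id m (xs ++ ys))

++-+ᵥ : (x : Vec ℤ m) (y : Vec ℤ n) (x′ : Vec ℤ m) (y′ : Vec ℤ n) →
  (x ++ y) +ᵥ (x′ ++ y′) ≡ (x +ᵥ x′) ++ (y +ᵥ y′)
++-+ᵥ = V.zipWith-++ ℤ._+_

0ᵥ-++ : ∀ m n → 0ᵥ {m} ++ 0ᵥ {n} ≡ 0ᵥ
0ᵥ-++ m n = sym (replicate-++ m n (+ 0))

module _ {d e : ℕ} where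

  μ-additive : Additive (μ {d} e)
  μ-additive =
    0ᵥ-++ d e ,
    λ x y → trans (cong ((x +ᵥ y) ++_) (sym (+ᵥ-identityˡ 0ᵥ))) (sym (++-+ᵥ x 0ᵥ y 0ᵥ))

  ν-additive : Additive (ν d {e})
  ν-additive =
    0ᵥ-++ d e ,
    λ x y → trans (cong (_++ (x +ᵥ y)) (sym (+ᵥ-identityˡ 0ᵥ))) (sym (++-+ᵥ 0ᵥ x 0ᵥ y))

  take-additive : Additive (take d {e})
  take-additive = trans (cong (take d) (replicate-++ d e (+ 0))) (take-++ 0ᵥ (0ᵥ {e})) , V.take-zipWith ℤ._+_

  drop-additive : Additive (drop d {e})
  drop-additive = trans (cong (drop d) (replicate-++ d e (+ 0))) (drop-++ (0ᵥ {d}) 0ᵥ) , V.drop-zipWith ℤ._+_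

μ∪ν : ∀ {d e} → List (Vec ℤ d) → List (Vec ℤ e) → Pred (Vec ℤ (d + e)) 0ℓ
μ∪ν {d} {e} vs ws =
  (λ γ → Σ _ λ α → Pts vs α × γ ≡ μ e α) ∪ (λ γ → Σ _ λ β → Pts ws β × γ ≡ ν d β)

module FreeSum {d e : ℕ} (vs : List (Vec ℤ d)) (ws : List (Vec ℤ e))
  (0∈P : Pts vs 0ᵥ) (0∈Q : Pts ws 0ᵥ) (Pts≐μ∪ν : Pts (freeSum vs ws) ≐ μ∪ν vs ws) where

  F : List (Vec ℤ (d + e))
  F = freeSum vs ws

  SumPairs : ℕ → Pred (Vec ℤ d × Vec ℤ e) 0ℓ
  SumPairs = Antidiagonal (SumOf (Pts vs)) (SumOf (Pts ws))

  sums-split : ∀ {n γ} → SumOf (Pts F) n γ → ∃ λ ab → SumPairs n ab × γ ≡ uncurry _++_ ab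
  sums-split ([] , [] , refl) =
    (0ᵥ , 0ᵥ) , (0 , 0 , refl , ([] , [] , refl) , ([] , [] , refl)) , sym (0ᵥ-++ d e)
  sums-split (g ∷ gs , g∈F ∷ gs∈F , refl)
    with sums-split (gs , gs∈F , refl) | proj₁ Pts≐μ∪ν g∈F
  ... | (a , b) , (i , j , refl , Σa , Σb) , Σgs≡ | inj₁ (α , α∈P , refl) =
    (α +ᵥ a , b) , (suc i , j , refl , SumOf-∷ α∈P Σa , Σb) ,
    trans (cong (μ e α +ᵥ_) Σgs≡) (trans (++-+ᵥ α 0ᵥ a b) (cong ((α +ᵥ a) ++_) (+ᵥ-identityˡ b)))
  ... | (a , b) , (i , j , refl , Σa , Σb) , Σgs≡ | inj₂ (β , β∈Q , refl) =
    (a , β +ᵥ b) , (i , suc j , ℕ.+-suc i j , Σa , SumOf-∷ β∈Q Σb) ,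
    trans (cong (ν d β +ᵥ_) Σgs≡) (trans (++-+ᵥ 0ᵥ β a b) (cong (_++ (β +ᵥ b)) (+ᵥ-identityˡ a)))

  sums-join : ∀ {n a b} → SumPairs n (a , b) → SumOf (Pts F) n (a ++ b)
  sums-join {a = a} {b} (i , j , refl , Σa , Σb) =
    subst (SumOf (Pts F) (i + j)) μa+νb≡a++b
      (SumOf-+ (SumOf-map μ-additive (λ α∈P → proj₂ Pts≐μ∪ν (inj₁ (_ , α∈P , refl))) Σa)
               (SumOf-map ν-additive (λ β∈Q → proj₂ Pts≐μ∪ν (inj₂ (_ , β∈Q , refl))) Σb))
    where
    μa+νb≡a++b : μ e a +ᵥ ν d b ≡ a ++ b
    μa+νb≡a++b = trans (++-+ᵥ a 0ᵥ 0ᵥ b) (cong₂ _++_ (+ᵥ-identityʳ a) (+ᵥ-identityˡ b))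

  hilbert-freeSum : ∀ {HA HB HAB} → IsHilbertFn vs HA → IsHilbertFn ws HB → IsHilbertFn F HAB →
    ofℕ HAB ≗ oneMinusλ (ofℕ HA) ⊛ ofℕ HB
  hilbert-freeSum hA hB hAB n =
    let s , |SumPairs| , +s≡ =
          Chains.|Antidiagonal| (V.≡-dec ℤ._≟_) (SumOf (Pts vs)) (SumOf (Pts ws))
            (sumset-size vs hA) (sumset-size ws hB) (λ _ → SumOf-mono 0∈P) (λ _ → SumOf-mono 0∈Q) n
    in trans (cong +_ (HasSize-unique (sumset-size F hAB n)
                         (HasSize-image (uncurry _++_) ++-injective sums-join sums-split |SumPairs|)))
             +s≡
    where
    ++-injective : ∀ {ab ab′} → SumPairs n ab → SumPairs n ab′ →
      uncurry _++_ ab ≡ uncurry _++_ ab′ → ab ≡ ab′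
    ++-injective {a , b} {a′ , b′} _ _ eq with V.++-injective a a′ eq
    ... | refl , refl = refl

  IDPˡ : IDP F → IDP vs
  IDPˡ idp n 1≤n γ γ∈nP =
    subst (SumOf (Pts vs) n) (take-++ γ 0ᵥ)
      (SumOf-map take-additive take-Pts (idp n 1≤n (μ e γ) (LatticePt-μ vs ws {n} γ∈nP)))
    where
    take-Pts : ∀ {x} → Pts F x → Pts vs (take d x)
    take-Pts x∈F with proj₁ Pts≐μ∪ν x∈F
    ... | inj₁ (α , α∈P , refl) = subst (Pts vs) (sym (take-++ α 0ᵥ)) α∈P
    ... | inj₂ (β , _ , refl)   = subst (Pts vs) (sym (take-++ (0ᵥ {d}) β)) 0∈P

  IDPʳ : IDP F → IDP ws
  IDPʳ idp n 1≤n γ γ∈nQ =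
    subst (SumOf (Pts ws) n) (drop-++ (0ᵥ {d}) γ)
      (SumOf-map drop-additive drop-Pts (idp n 1≤n (ν d γ) (LatticePt-ν vs ws {n} γ∈nQ)))
    where
    drop-Pts : ∀ {x} → Pts F x → Pts ws (drop d x)
    drop-Pts x∈F with proj₁ Pts≐μ∪ν x∈F
    ... | inj₁ (α , _ , refl)   = subst (Pts ws) (sym (drop-++ α 0ᵥ)) 0∈Q
    ... | inj₂ (β , β∈Q , refl) = subst (Pts ws) (sym (drop-++ (0ᵥ {d}) β)) β∈Q

lemma2p2 : (d e : ℕ) (vs : List (Vec ℤ d)) (ws : List (Vec ℤ e)) →
    FullDim vs → FullDim ws →
    LatticePt vs 1 (replicate d (+ 0)) → LatticePt ws 1 (replicate e (+ 0)) →
    ((γ : Vec ℤ (d + e)) →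
      (LatticePt (freeSum vs ws) 1 γ →
        (Σ (Vec ℤ d) λ α → LatticePt vs 1 α × γ ≡ μ e α)
        ⊎ (Σ (Vec ℤ e) λ β → LatticePt ws 1 β × γ ≡ ν d β))
      × ((Σ (Vec ℤ d) λ α → LatticePt vs 1 α × γ ≡ μ e α)
         ⊎ (Σ (Vec ℤ e) λ β → LatticePt ws 1 β × γ ≡ ν d β) →
        LatticePt (freeSum vs ws) 1 γ)) →
    (HA HB HAB iP iQ iPQ : ℕ → ℕ) →
    IsHilbertFn vs HA → IsHilbertFn ws HB → IsHilbertFn (freeSum vs ws) HAB →
    IsEhrhartFn vs iP → IsEhrhartFn ws iQ → IsEhrhartFn (freeSum vs ws) iPQ →
    ((n : ℕ) → hPoly (d + e) HAB n ≡ (hPoly d HA ⊛ hPoly e HB) n)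
    × (IDP (freeSum vs ws) →
       (n : ℕ) → δPoly (d + e) iPQ n ≡ (δPoly d iP ⊛ δPoly e iQ) n)
lemma2p2 d e vs ws _ _ 0∈P 0∈Q Pts⇔μ∪ν HA HB HAB iP iQ iPQ hA hB hAB eP eQ ePQ =
  h-multiplicative , δ-multiplicative
  where
  open FreeSum vs ws 0∈P 0∈Q ((λ {γ} → proj₁ (Pts⇔μ∪ν γ)) , (λ {γ} → proj₂ (Pts⇔μ∪ν γ)))

  h-multiplicative : hPoly (d + e) HAB ≗ hPoly d HA ⊛ hPoly e HB
  h-multiplicative = hPoly-⊛ d e (hilbert-freeSum hA hB hAB)

  δ-multiplicative : IDP F → δPoly (d + e) iPQ ≗ δPoly d iP ⊛ δPoly e iQ
  δ-multiplicative idp n = begin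
    δPoly (d + e) iPQ n          ≡⟨ IDP⇒δPoly≗hPoly F idp hAB ePQ n ⟩
    hPoly (d + e) HAB n          ≡⟨ h-multiplicative n ⟩
    (hPoly d HA ⊛ hPoly e HB) n  ≡⟨ ⊛-cong (IDP⇒δPoly≗hPoly vs (IDPˡ idp) hA eP)
                                           (IDP⇒δPoly≗hPoly ws (IDPʳ idp) hB eQ) n ⟨
    (δPoly d iP ⊛ δPoly e iQ) n  ∎
    where open ≡-Reasoning
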